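{- Let $G=(V,E)$ be a graph with $\mathrm{thin}(G)=k$ and let $v_1<\dots<v_n$ be an ordering of $V$. If $G$ is not complete, then there exist a clique $v_{i_1}<\dots<v_{i_k}$ of size $k$ in $G_<$ and a vertex $v_j>v_{i_1}$ such that $v_jv_{i_1}\notin E$.
   Context: Graphs are finite, simple, undirected. For a graph $G=(V,E)$, an ordering $v_1,\dots,v_n$ of $V$ and a partition of $V$ are consistent if for every $r<s<t$, whenever $v_r,v_s$ are in the same class and $v_tv_r\in E$, then $v_tv_s\in E$. $\mathrm{thin}(G)$ is the minimum number of classes of a partition of $V$ consistent with some ordering of $V$. For an ordering $<$ of $V(G)$, $G_<$ is the graph with vertex set $V(G)$ in which, for $v<w$, $vw$ is an edge iff there is a vertex $z$ with $w<z$, $zv\in E(G)$ and $zw\notin E(G)$. -}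

module Defs where

open import Level using (0ℓ)
open import Data.Nat using (ℕ; _≤_)
open import Data.Fin using (Fin) renaming (_<_ to _<ᶠ_)
open import Data.Fin.Permutation using (Permutation′; _⟨$⟩ʳ_)
open import Data.Product using (Σ; _×_; ∃)
open import Data.Sum using (_⊎_)
open import Relation.Nullary using (¬_; Dec)
open import Relation.Binary.PropositionalEquality using (_≡_; _≢_)

record Graph (n : ℕ) : Set₁ where
  field
    Adj   : Fin n → Fin n → Set
    sym   : ∀ {u v} → Adj u v → Adj v u
    irrefl : ∀ {u} → ¬ Adj u u
    dec   : ∀ u v → Dec (Adj u v)
open Graph public

-- An ordering of V = Fin n, given by a bijection assigning each vertex its position.
Ordering : ℕ → Set
Ordering n = Permutation′ n

_≺[_]_ : ∀ {n} → Fin n → Ordering n → Fin n → Set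
u ≺[ π ] v = (π ⟨$⟩ʳ u) <ᶠ (π ⟨$⟩ʳ v)

-- A partition of V into (at most) k classes, given by a class map.
-- Consistency of an ordering with a partition.
Consistent : ∀ {n k} → Graph n → Ordering n → (Fin n → Fin k) → Set
Consistent G π c = ∀ r s t → r ≺[ π ] s → s ≺[ π ] t →
  c r ≡ c s → Adj G t r → Adj G t s

ThinAtMost : ∀ {n} → Graph n → ℕ → Set
ThinAtMost {n} G k = Σ (Ordering n) λ π → Σ (Fin n → Fin k) λ c → Consistent G π c

ThinIs : ∀ {n} → Graph n → ℕ → Set
ThinIs G k = ThinAtMost G k × (∀ m → ThinAtMost G m → k ≤ m)

LtEdgeDir : ∀ {n} → Graph n → Ordering n → Fin n → Fin n → Set
LtEdgeDir {n} G π v w = v ≺[ π ] w ×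
  Σ (Fin n) λ z → w ≺[ π ] z × Adj G z v × ¬ Adj G z w

LtAdj : ∀ {n} → Graph n → Ordering n → Fin n → Fin n → Set
LtAdj G π v w = LtEdgeDir G π v w ⊎ LtEdgeDir G π w v

Complete : ∀ {n} → Graph n → Set
Complete {n} G = ∀ (u v : Fin n) → u ≢ v → Adj G u v

module Submission where

-- Fix the ordering ≺ given by π and write x ◁ y when x ≺ y and every
-- vertex after y adjacent to x is adjacent to y.  The relation ◁ is a strict partial
-- order, and two distinct ◁-incomparable vertices are adjacent in G_<; so antichains
-- of ◁ are cliques of G_<.  Call v right-full if v is adjacent to every later vertex.
-- By Dilworth's theorem the non-right-full vertices split into m ◁-chains and contain
-- a ◁-antichain of size m.  Reordering so that the right-full vertices come last, and
-- using the chains as classes, gives an ordering consistent with an m-partition; hence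
-- thin(G) = k ≤ m.  Listing k members of the antichain in π-order gives the clique, and
-- its first vertex, being not right-full, has a later non-neighbour.

open import Defs hiding (sym)
open import Data.Nat using (ℕ)
open import Data.Fin using (Fin; toℕ) renaming (_<_ to _<ᶠ_)
open import Data.Product using (Σ; _×_)
open import Relation.Nullary using (¬_)
open import Relation.Binary.PropositionalEquality using (_≡_; _≢_)

open import Level using (0ℓ)
open import Data.Nat using (zero; suc; _≤_; _<_; z≤n; s≤s; s≤s⁻¹; _+_)
open import Data.Nat.Properties as ℕ using ()
open import Data.Fin using (fromℕ; fromℕ<; inject≤; punchIn; punchOut)
  renaming (zero to fzero; suc to fsuc)
open import Data.Fin.Properties
  using (_≟_; _<?_; any?; all?; ¬∀⟶∃¬; injective⇒≤; punchOut-injective; toℕ<n;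
         toℕ-fromℕ; toℕ-fromℕ<; <-cmp; toℕ-inject≤; inject≤-injective; toℕ-injective)
open import Data.Fin.Permutation
  using (Permutation′; _⟨$⟩ʳ_; _⟨$⟩ˡ_; _∘ₚ_; id; lift₀; insert; inverseˡ; inverseʳ)
open import Data.Vec using (Vec; []; _∷_; lookup; tabulate)
open import Data.Vec.Properties using (lookup∘tabulate)
open import Data.Product using (∃; _,_; proj₁; proj₂)
open import Data.Sum using (_⊎_; inj₁; inj₂)
open import Data.Empty using (⊥-elim)
open import Function using (_∘_)
open import Relation.Nullary using (Dec; yes; no; ¬?; contradiction)
open import Relation.Nullary.Decidable using (_×-dec_; _⊎-dec_; _→-dec_; map′)
open import Relation.Unary using (Pred; Decidable)
open import Relation.Binary using (tri<; tri≈; tri>)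
open import Relation.Binary.PropositionalEquality
  using (refl; sym; trans; cong; subst; subst₂; module ≡-Reasoning)

injective⇒surjective : ∀ {m} (φ : Fin m → Fin m) → (∀ {l l'} → φ l ≡ φ l' → l ≡ l') →
  ∀ i → ∃ λ l → φ l ≡ i
injective⇒surjective {suc m} φ φ-injective i with any? (λ l → φ l ≟ i)
... | yes hit = hit
... | no miss = contradiction (injective⇒≤ skip-injective) ℕ.1+n≰n
  where
  -- If i were missed, φ would inject Fin (suc m) into the m-element set Fin (suc m) ∖ {i}.
  skip : Fin (suc m) → Fin m
  skip l = punchOut {i = i} {j = φ l} (λ e → miss (l , sym e))
  skip-injective : ∀ {l l'} → skip l ≡ skip l' → l ≡ l'
  skip-injective {l} {l'} e =
    φ-injective (punchOut-injective {i = i} (λ e → miss (l , sym e)) (λ e → miss (l' , sym e)) e)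

∃-vector? : ∀ {N} m {P : Vec (Fin N) m → Set} → (∀ v → Dec (P v)) → Dec (∃ P)
∃-vector? zero P? with P? []
... | yes p = yes ([] , p)
... | no ¬p = no λ { ([] , p) → ¬p p }
∃-vector? (suc m) {P} P? with any? (λ a → ∃-vector? m {P ∘ (a ∷_)} (P? ∘ (a ∷_)))
... | yes (a , v , p) = yes (a ∷ v , p)
... | no ¬p = no λ { (a ∷ v , p) → ¬p (a , v , p) }

counterexample : ∀ {N} {P Q : Pred (Fin N) 0ℓ} → Decidable P → Decidable Q →
  ¬ (∀ t → P t → Q t) → ∃ λ t → P t × ¬ Q t
counterexample {N} P? Q? fails with ¬∀⟶∃¬ N _ (λ t → P? t →-dec Q? t) fails
... | t , ¬P⇒Q with P? t | Q? t
... | yes p | no ¬q = t , p , ¬q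
... | yes _ | yes q = contradiction (λ _ → q) ¬P⇒Q
... | no ¬p | _     = contradiction (λ p → ⊥-elim (¬p p)) ¬P⇒Q

StrictlyIncreasing : ∀ {m N} → (Fin m → Fin N) → Set
StrictlyIncreasing e = ∀ {i j} → i <ᶠ j → e i <ᶠ e j

increasing⇒injective : ∀ {m N} {e : Fin m → Fin N} → StrictlyIncreasing e →
  ∀ {i j} → e i ≡ e j → i ≡ j
increasing⇒injective increasing {i} {j} eq with <-cmp i j
... | tri< i<j _ _ = contradiction (cong toℕ eq) (ℕ.<⇒≢ (increasing i<j))
... | tri≈ _ i≡j _ = i≡j
... | tri> _ _ j<i = contradiction (cong toℕ (sym eq)) (ℕ.<⇒≢ (increasing j<i))

record Enumeration {N : ℕ} (Q : Pred (Fin N) 0ℓ) : Set where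
  field
    size       : ℕ
    element    : Fin size → Fin N
    increasing : StrictlyIncreasing element
    member     : ∀ i → Q (element i)
    complete   : ∀ {p} → Q p → ∃ λ i → element i ≡ p

enumerate : ∀ {N} {Q : Pred (Fin N) 0ℓ} → Decidable Q → Enumeration Q
enumerate {zero} Q? = record
  { size = 0 ; element = λ () ; increasing = λ {} ; member = λ () ; complete = λ {} }
enumerate {suc N} {Q} Q? with enumerate (Q? ∘ fsuc) | Q? fzero
... | E | yes q₀ = record
  { size = suc size ; element = element′ ; increasing = increasing′
  ; member = member′ ; complete = complete′ }
  where
  open Enumeration E
  element′ : Fin (suc size) → Fin (suc N)
  element′ fzero    = fzero
  element′ (fsuc i) = fsuc (element i)
  increasing′ : StrictlyIncreasing element′
  increasing′ {fzero}  {fsuc j} _           = s≤s z≤n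
  increasing′ {fsuc i} {fsuc j} (s≤s i<j) = s≤s (increasing i<j)
  member′ : ∀ i → Q (element′ i)
  member′ fzero    = q₀
  member′ (fsuc i) = member i
  complete′ : ∀ {p} → Q p → ∃ λ i → element′ i ≡ p
  complete′ {fzero}  _ = fzero , refl
  complete′ {fsuc p} q with complete q
  ... | i , eq = fsuc i , cong fsuc eq
... | E | no ¬q₀ = record
  { size = size ; element = fsuc ∘ element ; increasing = s≤s ∘ increasing
  ; member = member ; complete = complete′ }
  where
  open Enumeration E
  complete′ : ∀ {p} → Q p → ∃ λ i → fsuc (element i) ≡ p
  complete′ {fzero}  q = contradiction q ¬q₀
  complete′ {fsuc p} q with complete q
  ... | i , eq = i , cong fsuc eq

inject≤-increasing : ∀ {m m'} (m≤m' : m ≤ m') → StrictlyIncreasing (λ (i : Fin m) → inject≤ i m≤m')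
inject≤-increasing m≤m' {i} {j} i<j =
  subst₂ _<_ (sym (toℕ-inject≤ i m≤m')) (sym (toℕ-inject≤ j m≤m')) i<j

sortFamily : ∀ {m N} (g : Fin m → Fin N) → (∀ {l l'} → g l ≡ g l' → l ≡ l') →
  Σ (Fin m → Fin N) λ e → StrictlyIncreasing e × (∀ i → ∃ λ l → g l ≡ e i)
sortFamily {m} g g-injective =
  element ∘ shrink , increasing ∘ inject≤-increasing m≤size , member ∘ shrink
  where
  open Enumeration (enumerate (λ p → any? (λ l → g l ≟ p)))
  index : Fin m → Fin size
  index l = proj₁ (complete (l , refl))
  index-injective : ∀ {l l'} → index l ≡ index l' → l ≡ l'
  index-injective {l} {l'} eq = g-injective (begin
    g l                ≡⟨ sym (proj₂ (complete (l , refl))) ⟩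
    element (index l)  ≡⟨ cong element eq ⟩
    element (index l') ≡⟨ proj₂ (complete (l' , refl)) ⟩
    g l'               ∎)
    where open ≡-Reasoning
  m≤size : m ≤ size
  m≤size = injective⇒≤ index-injective
  shrink : Fin m → Fin size
  shrink i = inject≤ i m≤size

toℕ-punchIn-last : ∀ {n} (x : Fin n) → toℕ (punchIn (fromℕ n) x) ≡ toℕ x
toℕ-punchIn-last {suc n} fzero    = refl
toℕ-punchIn-last {suc n} (fsuc x) = cong suc (toℕ-punchIn-last x)

-- Stable partition: a permutation of positions that moves those satisfying P to the end,
-- keeping the relative order inside both parts.
stablePartition : ∀ {n} {P : Pred (Fin n) 0ℓ} → Decidable P → Permutation′ n
stablePartition {zero}  P? = id
stablePartition {suc n} P? with P? fzero
... | yes _ = insert fzero (fromℕ n) (stablePartition (P? ∘ fsuc))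
... | no _  = lift₀ (stablePartition (P? ∘ fsuc))

shiftSuc : ∀ {n} {A B C : Set} {p q : Fin n} → A ⊎ (B × C × p <ᶠ q) → A ⊎ (B × C × fsuc p <ᶠ fsuc q)
shiftSuc (inj₁ a)             = inj₁ a
shiftSuc (inj₂ (b , c , p<q)) = inj₂ (b , c , s≤s p<q)

stablePartition-order : ∀ {n} {P : Pred (Fin n) 0ℓ} (P? : Decidable P) {p q : Fin n} →
  stablePartition P? ⟨$⟩ʳ p <ᶠ stablePartition P? ⟨$⟩ʳ q → P q ⊎ (¬ P p × ¬ P q × p <ᶠ q)
stablePartition-order {suc n} P? moved with P? fzero
-- position 0 satisfies P: it goes to the last place, position k+1 to the place of k
stablePartition-order {suc n} P? {fzero} {fzero} moved | yes _ =
  contradiction moved (ℕ.<-irrefl refl)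
stablePartition-order {suc n} P? {fzero} {fsuc q} moved | yes _ =
  contradiction moved (ℕ.<-asym (subst₂ _<_ (sym (toℕ-punchIn-last _)) (sym (toℕ-fromℕ n))
    (toℕ<n (stablePartition (P? ∘ fsuc) ⟨$⟩ʳ q))))
stablePartition-order {suc n} P? {fsuc p} {fzero} moved | yes P₀ = inj₁ P₀
stablePartition-order {suc n} P? {fsuc p} {fsuc q} moved | yes _ =
  shiftSuc (stablePartition-order (P? ∘ fsuc)
    (subst₂ _<_ (toℕ-punchIn-last _) (toℕ-punchIn-last _) moved))
-- position 0 violates P: it stays first and the rest is partitioned recursively
stablePartition-order {suc n} P? {fzero} {fzero} () | no _
stablePartition-order {suc n} P? {fzero} {fsuc q} moved | no ¬P₀ with P? (fsuc q)
... | yes Pq = inj₁ Pq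
... | no ¬Pq = inj₂ (¬P₀ , ¬Pq , s≤s z≤n)
stablePartition-order {suc n} P? {fsuc p} {fzero} () | no _
stablePartition-order {suc n} P? {fsuc p} {fsuc q} moved | no _ =
  shiftSuc (stablePartition-order (P? ∘ fsuc) (s≤s⁻¹ moved))

-- Dilworth's theorem, for a decidable strict order _⊏_ on Fin n that comes with a
-- linear extension: an injective rank function, increasing along ⊏.
module Dilworth {n : ℕ} (_⊏_ : Fin n → Fin n → Set) (_⊏?_ : ∀ x y → Dec (x ⊏ y))
  (⊏-trans : ∀ {x y z} → x ⊏ y → y ⊏ z → x ⊏ z)
  (rank : Fin n → ℕ) (rank-injective : ∀ {x y} → rank x ≡ rank y → x ≡ y)
  (rank-mono : ∀ {x y} → x ⊏ y → rank x < rank y) (rank-bound : ∀ x → rank x < n) where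

  Subset : Set₁
  Subset = Pred (Fin n) 0ℓ

  Comparable : Fin n → Fin n → Set
  Comparable x y = x ≡ y ⊎ x ⊏ y ⊎ y ⊏ x

  Incomparable : Fin n → Fin n → Set
  Incomparable x y = ¬ Comparable x y

  comparable? : ∀ x y → Dec (Comparable x y)
  comparable? x y = (x ≟ y) ⊎-dec ((x ⊏? y) ⊎-dec (y ⊏? x))

  comparable-sym : ∀ {x y} → Comparable x y → Comparable y x
  comparable-sym (inj₁ x≡y)        = inj₁ (sym x≡y)
  comparable-sym (inj₂ (inj₁ x⊏y)) = inj₂ (inj₂ x⊏y)
  comparable-sym (inj₂ (inj₂ y⊏x)) = inj₂ (inj₁ y⊏x)

  record ChainPartition (S : Subset) (m : ℕ) : Set where
    field
      colour   : Fin n → ℕ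
      colour-< : ∀ {x} → S x → colour x < m
      chain    : ∀ {x y} → S x → S y → colour x ≡ colour y → Comparable x y

  record IsAntichain (S : Subset) (m : ℕ) (g : Fin m → Fin n) : Set where
    constructor isAntichain
    field
      members      : ∀ l → S (g l)
      incomparable : ∀ l l' → l ≢ l' → Incomparable (g l) (g l')
  open IsAntichain public

  isAntichain? : ∀ {S} → Decidable S → ∀ m g → Dec (IsAntichain S m g)
  isAntichain? S? m g = map′ (λ (in-S , pairwise) → isAntichain in-S pairwise)
    (λ A → members A , incomparable A)
    (all? (λ l → S? (g l)) ×-dec
     all? (λ l → all? (λ l' → ¬? (l ≟ l') →-dec ¬? (comparable? (g l) (g l')))))

  -- The conclusion of Dilworth's theorem for S: a chain partition and an antichain of
  -- the same size.
  record Width (S : Subset) : Set where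
    field
      width        : ℕ
      chains       : ChainPartition S width
      antichain    : Fin width → Fin n
      is-antichain : IsAntichain S width antichain

  restrict : ∀ {S S' m m'} → (∀ {x} → S' x → S x) → m ≤ m' →
    ChainPartition S m → ChainPartition S' m'
  restrict S'⊆S m≤m' P = record
    { colour   = colour
    ; colour-< = λ x∈S' → ℕ.<-≤-trans (colour-< (S'⊆S x∈S')) m≤m'
    ; chain    = λ x∈S' y∈S' → chain (S'⊆S x∈S') (S'⊆S y∈S')
    }
    where open ChainPartition P

  addChain : ∀ {S m} (K : Subset) → Decidable K → (∀ {x y} → K x → K y → Comparable x y) →
    ChainPartition (λ x → S x × ¬ K x) m → ChainPartition S (suc m)
  addChain {S} {m} K K? K-chain P = record
    { colour = colour′ ; colour-< = colour′-< ; chain = chain′ }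
    where
    open ChainPartition P
    colour′ : Fin n → ℕ
    colour′ x with K? x
    ... | yes _ = m
    ... | no _  = colour x
    colour′-< : ∀ {x} → S x → colour′ x < suc m
    colour′-< {x} x∈S with K? x
    ... | yes _  = ℕ.n<1+n m
    ... | no ¬Kx = ℕ.m<n⇒m<1+n (colour-< (x∈S , ¬Kx))
    chain′ : ∀ {x y} → S x → S y → colour′ x ≡ colour′ y → Comparable x y
    chain′ {x} {y} x∈S y∈S same with K? x | K? y
    ... | yes Kx  | yes Ky  = K-chain Kx Ky
    ... | yes _   | no ¬Ky  = contradiction (colour-< (y∈S , ¬Ky)) (ℕ.<-irrefl (sym same))
    ... | no ¬Kx  | yes _   = contradiction (colour-< (x∈S , ¬Kx)) (ℕ.<-irrefl same)
    ... | no ¬Kx  | no ¬Ky  = chain (x∈S , ¬Kx) (y∈S , ¬Ky) same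

  antichain-⊆ : ∀ {S S' m g} → (∀ {x} → S x → S' x) → IsAntichain S m g → IsAntichain S' m g
  antichain-⊆ S⊆S' (isAntichain in-S pairwise) = isAntichain (S⊆S' ∘ in-S) pairwise

  antichain-prefix : ∀ {S m m' g} (m≤m' : m ≤ m') → IsAntichain S m' g →
    IsAntichain S m (λ l → g (inject≤ l m≤m'))
  antichain-prefix m≤m' (isAntichain in-S pairwise) = isAntichain (λ l → in-S _)
    (λ l l' l≢l' → pairwise _ _ (l≢l' ∘ inject≤-injective m≤m' m≤m' l l'))

  antichain-cong : ∀ {S m g g'} → (∀ l → g l ≡ g' l) → IsAntichain S m g → IsAntichain S m g'
  antichain-cong {S} g≗g' (isAntichain in-S pairwise) = isAntichain
    (λ l → subst S (g≗g' l) (in-S l))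
    (λ l l' l≢l' → subst₂ Incomparable (g≗g' l) (g≗g' l') (pairwise l l' l≢l'))

  -- In a partition of S into m chains, an antichain of size m in S meets every chain:
  -- distinct members have distinct colours, so the colouring is a bijection on Fin m.
  antichain-meets-chains : ∀ {S m g} (P : ChainPartition S m) → IsAntichain S m g →
    ∀ (i : Fin m) → ∃ λ l → ChainPartition.colour P (g l) ≡ toℕ i
  antichain-meets-chains {S} {m} {g} P (isAntichain in-S pairwise) i = l , colour≡i
    where
    open ChainPartition P
    φ : Fin m → Fin m
    φ l = fromℕ< (colour-< (in-S l))
    φ-injective : ∀ {l l'} → φ l ≡ φ l' → l ≡ l'
    φ-injective {l} {l'} eq with l ≟ l'
    ... | yes l≡l' = l≡l'
    ... | no l≢l' = contradiction (chain (in-S l) (in-S l') same-colour) (pairwise l l' l≢l')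
      where
      same-colour : colour (g l) ≡ colour (g l')
      same-colour = trans (sym (toℕ-fromℕ< _)) (trans (cong toℕ eq) (toℕ-fromℕ< _))
    l : Fin m
    l = proj₁ (injective⇒surjective φ φ-injective i)
    colour≡i : colour (g l) ≡ toℕ i
    colour≡i = trans (sym (toℕ-fromℕ< _)) (cong toℕ (proj₂ (injective⇒surjective φ φ-injective i)))

  -- A nonempty decidable subset has an element with no Rel-successor inside it, for any
  -- relation along which the rank increases (climb along Rel; the rank bounds the climb).
  maximal : (Rel : Fin n → Fin n → Set) → (∀ x y → Dec (Rel x y)) →
    (∀ {x y} → Rel x y → rank x < rank y) →
    ∀ {Q : Subset} → Decidable Q → ∀ {y} → Q y → Σ (Fin n) λ z → Q z × (∀ {w} → Q w → ¬ Rel z w)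
  maximal Rel Rel? increasing {Q} Q? {y} y∈Q = climb n y∈Q (ℕ.m≤m+n n (rank y))
    where
    climb : ∀ fuel {y} → Q y → n ≤ fuel + rank y →
      Σ (Fin n) λ z → Q z × (∀ {w} → Q w → ¬ Rel z w)
    climb zero {y} _ n≤rank = contradiction (rank-bound y) (ℕ.≤⇒≯ n≤rank)
    climb (suc fuel) {y} y∈Q bound with any? (λ w → Q? w ×-dec Rel? y w)
    ... | yes (w , w∈Q , y→w) = climb fuel w∈Q (ℕ.≤-trans bound
          (subst (_≤ fuel + rank w) (ℕ.+-suc fuel (rank y)) (ℕ.+-monoʳ-≤ fuel (increasing y→w))))
    ... | no stuck = y , y∈Q , λ w∈Q y→w → stuck (_ , w∈Q , y→w)

  empty : ∀ {S} → (∀ {x} → ¬ S x) → Width S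
  empty none = record
    { width = 0
    ; chains = record
      { colour = λ _ → 0 ; colour-< = λ x∈S → contradiction x∈S none
      ; chain = λ x∈S _ _ → contradiction x∈S none }
    ; antichain = λ ()
    ; is-antichain = isAntichain (λ ()) (λ ())
    }

  -- Induction step (Galvin's proof): a is a rank-maximal element of S, and the theorem is
  -- already known for every decidable subset of S ∖ {a}.
  module Step (S : Subset) (S? : Decidable S) (a : Fin n) (a∈S : S a)
    (a-top : ∀ {x} → S x → x ≢ a → rank x < rank a)
    (IH : ∀ (T : Subset) → Decidable T → (∀ {x} → T x → rank x < rank a) → Width T) where

    S₁ : Subset
    S₁ x = S x × rank x < rank a

    S₁? : Decidable S₁
    S₁? x = S? x ×-dec (rank x ℕ.<? rank a)

    S∖a⊆S₁ : ∀ {x} → S x → x ≢ a → S₁ x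
    S∖a⊆S₁ x∈S x≢a = x∈S , a-top x∈S x≢a

    open Width (IH S₁ S₁? proj₂)
      renaming (width to m; chains to P₁; antichain to A₁; is-antichain to A₁-antichain)
    open ChainPartition P₁ using (colour; chain)

    InMaxAntichain : Subset
    InMaxAntichain x = Σ (Vec (Fin n) m) λ v → IsAntichain S₁ m (lookup v) × ∃ λ l → lookup v l ≡ x

    inMaxAntichain? : Decidable InMaxAntichain
    inMaxAntichain? x =
      ∃-vector? m (λ v → isAntichain? S₁? m (lookup v) ×-dec any? (λ l → lookup v l ≟ x))

    inMaxAntichain : ∀ {g} → IsAntichain S₁ m g → ∀ l → InMaxAntichain (g l)
    inMaxAntichain {g} g-antichain l =
      tabulate g , antichain-cong {S₁} {m} {g} (λ l → sym (lookup∘tabulate g l)) g-antichain ,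
      l , lookup∘tabulate g l

    Candidate : Fin m → Subset
    Candidate i x = S₁ x × colour x ≡ toℕ i × InMaxAntichain x

    candidate? : ∀ i → Decidable (Candidate i)
    candidate? i x = S₁? x ×-dec (colour x ℕ.≟ toℕ i) ×-dec inMaxAntichain? x

    -- top i: a ⊏-maximal candidate of chain i (there is one, since A₁ meets chain i);
    -- opaque, as only this specification is used.
    opaque
      top-spec : ∀ i → Σ (Fin n) λ z → Candidate i z × (∀ {w} → Candidate i w → ¬ z ⊏ w)
      top-spec i with antichain-meets-chains P₁ A₁-antichain i
      ... | l , colour≡i = maximal _⊏_ _⊏?_ rank-mono (candidate? i)
        (members A₁-antichain l , colour≡i , inMaxAntichain A₁-antichain l)

    top : Fin m → Fin n
    top i = proj₁ (top-spec i)

    top-candidate : ∀ i → Candidate i (top i)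
    top-candidate i = proj₁ (proj₂ (top-spec i))

    colour-top : ∀ i → colour (top i) ≡ toℕ i
    colour-top i = proj₁ (proj₂ (top-candidate i))

    -- Being on one chain, every candidate of chain i lies weakly below top i.
    below-top : ∀ {i w} → Candidate i w → w ≡ top i ⊎ w ⊏ top i
    below-top {i} w-candidate@(w∈S₁ , colour≡i , _)
      with chain w∈S₁ (proj₁ (top-candidate i)) (trans colour≡i (sym (colour-top i)))
    ... | inj₁ w≡top        = inj₁ w≡top
    ... | inj₂ (inj₁ w⊏top) = inj₂ w⊏top
    ... | inj₂ (inj₂ top⊏w) = contradiction top⊏w (proj₂ (proj₂ (top-spec i)) w-candidate)

    -- No top lies below another: a maximum antichain through top j meets chain i in a
    -- candidate y ⊑ top i, and top i ⊏ top j would put y below top j on that antichain.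
    top-not-below : ∀ {i j} → i ≢ j → ¬ top i ⊏ top j
    top-not-below {i} {j} i≢j top-i⊏top-j with proj₂ (proj₂ (top-candidate j))
    ... | v , v-antichain , l' , vl'≡top-j with antichain-meets-chains P₁ v-antichain i
    ... | l , colour≡i = y-not-below-top-j (y-below-top-j (below-top y-candidate))
      where
      y : Fin n
      y = lookup v l
      y-candidate : Candidate i y
      y-candidate = members v-antichain l , colour≡i , v , v-antichain , l , refl
      y-below-top-j : y ≡ top i ⊎ y ⊏ top i → y ⊏ top j
      y-below-top-j (inj₁ y≡top-i) = subst (_⊏ top j) (sym y≡top-i) top-i⊏top-j
      y-below-top-j (inj₂ y⊏top-i) = ⊏-trans y⊏top-i top-i⊏top-j
      y-not-below-top-j : ¬ y ⊏ top j
      y-not-below-top-j y⊏top-j with l ≟ l'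
      ... | yes refl = i≢j (toℕ-injective
            (trans (sym colour≡i) (trans (cong colour vl'≡top-j) (colour-top j))))
      ... | no l≢l' =
        incomparable v-antichain l l' l≢l' (inj₂ (inj₁ (subst (y ⊏_) (sym vl'≡top-j) y⊏top-j)))

    tops-incomparable : ∀ {i j} → i ≢ j → Incomparable (top i) (top j)
    tops-incomparable i≢j (inj₁ top-i≡top-j) =
      i≢j (toℕ-injective
        (trans (sym (colour-top _)) (trans (cong colour top-i≡top-j) (colour-top _))))
    tops-incomparable i≢j (inj₂ (inj₁ top-i⊏top-j)) = top-not-below i≢j top-i⊏top-j
    tops-incomparable i≢j (inj₂ (inj₂ top-j⊏top-i)) = top-not-below (i≢j ∘ sym) top-j⊏top-i

    -- Case 1: no top lies below a.  Then a and the tops form an antichain of size m + 1,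
    -- and {a} is the (m + 1)-st chain.
    module NoTopBelow (not-below : ∀ i → ¬ top i ⊏ a) where
      top-below-a : ∀ i → rank (top i) < rank a
      top-below-a i = proj₂ (proj₁ (top-candidate i))

      top-incomparable-a : ∀ i → Incomparable (top i) a
      top-incomparable-a i (inj₁ top≡a)        = ℕ.<-irrefl (cong rank top≡a) (top-below-a i)
      top-incomparable-a i (inj₂ (inj₁ top⊏a)) = not-below i top⊏a
      top-incomparable-a i (inj₂ (inj₂ a⊏top)) = ℕ.<-asym (rank-mono a⊏top) (top-below-a i)

      extended : Fin (suc m) → Fin n
      extended fzero    = a
      extended (fsuc i) = top i

      extended-in-S : ∀ l → S (extended l)
      extended-in-S fzero    = a∈S
      extended-in-S (fsuc i) = proj₁ (proj₁ (top-candidate i))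

      extended-incomparable : ∀ l l' → l ≢ l' → Incomparable (extended l) (extended l')
      extended-incomparable fzero    fzero    l≢l' = contradiction refl l≢l'
      extended-incomparable fzero    (fsuc j) _    = top-incomparable-a j ∘ comparable-sym
      extended-incomparable (fsuc i) fzero    _    = top-incomparable-a i
      extended-incomparable (fsuc i) (fsuc j) l≢l' = tops-incomparable (l≢l' ∘ cong fsuc)

      witness : Width S
      witness = record
        { width        = suc m
        ; chains       = addChain (_≡ a) (_≟ a) (λ x≡a y≡a → inj₁ (trans x≡a (sym y≡a)))
                           (restrict (λ (x∈S , x≢a) → S∖a⊆S₁ x∈S x≢a) ℕ.≤-refl P₁)
        ; antichain    = extended
        ; is-antichain = isAntichain extended-in-S extended-incomparable
        }

    -- Case 2: top i ⊏ a.  Then K = {a} ∪ {x on chain i | x ⊑ top i} is a chain, and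
    -- S₂ = S₁ ∖ K has fewer than m chains; adding K gives m chains for S.
    module TopBelow (i : Fin m) (top⊏a : top i ⊏ a) where
      K : Subset
      K x = x ≡ a ⊎ (S₁ x × colour x ≡ toℕ i × (x ≡ top i ⊎ x ⊏ top i))

      K? : Decidable K
      K? x = (x ≟ a) ⊎-dec (S₁? x ×-dec (colour x ℕ.≟ toℕ i) ×-dec ((x ≟ top i) ⊎-dec (x ⊏? top i)))

      below-a : ∀ {x} → x ≡ top i ⊎ x ⊏ top i → x ⊏ a
      below-a (inj₁ x≡top) = subst (_⊏ a) (sym x≡top) top⊏a
      below-a (inj₂ x⊏top) = ⊏-trans x⊏top top⊏a

      K-chain : ∀ {x y} → K x → K y → Comparable x y
      K-chain (inj₁ x≡a) (inj₁ y≡a) = inj₁ (trans x≡a (sym y≡a))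
      K-chain {x} {y} (inj₁ x≡a) (inj₂ (_ , _ , y⊑top)) =
        inj₂ (inj₂ (subst (y ⊏_) (sym x≡a) (below-a y⊑top)))
      K-chain {x} {y} (inj₂ (_ , _ , x⊑top)) (inj₁ y≡a) =
        inj₂ (inj₁ (subst (x ⊏_) (sym y≡a) (below-a x⊑top)))
      K-chain (inj₂ (x∈S₁ , x-colour , _)) (inj₂ (y∈S₁ , y-colour , _)) =
        chain x∈S₁ y∈S₁ (trans x-colour (sym y-colour))

      S₂ : Subset
      S₂ x = S₁ x × ¬ K x

      S∖K⊆S₂ : ∀ {x} → S x × ¬ K x → S₂ x
      S∖K⊆S₂ (x∈S , ¬Kx) = S∖a⊆S₁ x∈S (¬Kx ∘ inj₁) , ¬Kx

      open Width (IH S₂ (λ x → S₁? x ×-dec ¬? (K? x)) (proj₂ ∘ proj₁))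
        renaming (width to m₂; chains to P₂; antichain to A₂; is-antichain to A₂-antichain)

      -- If m ≤ m₂, the first m members of A₂ form an antichain of S₂ of size m.
      prefix : m ≤ m₂ → Fin m → Fin n
      prefix m≤m₂ l = A₂ (inject≤ l m≤m₂)

      prefix-antichain : (m≤m₂ : m ≤ m₂) → IsAntichain S₂ m (prefix m≤m₂)
      prefix-antichain m≤m₂ = antichain-prefix m≤m₂ A₂-antichain

      -- Such an antichain would be a maximum antichain of S₁; it would meet chain i in a
      -- candidate, which lies below top i and hence in K, contradicting S₂ ∩ K = ∅.
      m≰m₂ : ¬ m ≤ m₂
      m≰m₂ m≤m₂ with antichain-meets-chains P₁ max-antichain i
        where
        max-antichain : IsAntichain S₁ m (prefix m≤m₂)
        max-antichain = antichain-⊆ proj₁ (prefix-antichain m≤m₂)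
      ... | l , colour≡i = outside-K (inj₂ (x∈S₁ , colour≡i , below-top x-candidate))
        where
        outside-K : ¬ K (prefix m≤m₂ l)
        outside-K = proj₂ (members (prefix-antichain m≤m₂) l)
        x∈S₁ : S₁ (prefix m≤m₂ l)
        x∈S₁ = proj₁ (members (prefix-antichain m≤m₂) l)
        x-candidate : Candidate i (prefix m≤m₂ l)
        x-candidate = x∈S₁ , colour≡i , inMaxAntichain (antichain-⊆ proj₁ (prefix-antichain m≤m₂)) l

      witness : Width S
      witness = record
        { width        = m
        ; chains       = restrict (λ x∈S → x∈S) (ℕ.≰⇒> m≰m₂)
                           (addChain K K? K-chain (restrict S∖K⊆S₂ ℕ.≤-refl P₂))
        ; antichain    = A₁
        ; is-antichain = antichain-⊆ proj₁ A₁-antichain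
        }

    witness : Width S
    witness with any? (λ i → top i ⊏? a)
    ... | yes (i , top⊏a) = TopBelow.witness i top⊏a
    ... | no none         = NoTopBelow.witness (λ i top⊏a → none (i , top⊏a))

  width-below : ∀ b (S : Subset) → Decidable S → (∀ {x} → S x → rank x < b) → Width S
  width-below zero S S? below = empty (λ x∈S → ℕ.n≮0 (below x∈S))
  width-below (suc b) S S? below with any? S?
  ... | no nothing = empty (λ x∈S → nothing (_ , x∈S))
  ... | yes (x₀ , x₀∈S)
    with maximal (λ x y → rank x < rank y) (λ x y → rank x ℕ.<? rank y) (λ lt → lt) S? x₀∈S
  ... | a , a∈S , a-maximal = Step.witness S S? a a∈S a-top
          (λ T T? T-below → width-below b T T?
             (λ x∈T → ℕ.<-≤-trans (T-below x∈T) (s≤s⁻¹ (below a∈S))))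
    where
    a-top : ∀ {x} → S x → x ≢ a → rank x < rank a
    a-top {x} x∈S x≢a with ℕ.<-cmp (rank x) (rank a)
    ... | tri< lt _ _ = lt
    ... | tri≈ _ eq _ = contradiction (rank-injective eq) x≢a
    ... | tri> _ _ gt = contradiction gt (a-maximal x∈S)

  dilworth : (S : Subset) → Decidable S → Width S
  dilworth S S? = width-below n S S? (λ {x} _ → rank-bound x)

module OrderedGraph {n : ℕ} (G : Graph n) (π : Ordering n) where

  _≺_ : Fin n → Fin n → Set
  x ≺ y = x ≺[ π ] y

  _≺?_ : ∀ x y → Dec (x ≺ y)
  x ≺? y = (π ⟨$⟩ʳ x) <? (π ⟨$⟩ʳ y)

  π-injective : ∀ {x y} → π ⟨$⟩ʳ x ≡ π ⟨$⟩ʳ y → x ≡ y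
  π-injective {x} {y} eq = begin
    x                  ≡⟨ sym (inverseˡ π) ⟩
    π ⟨$⟩ˡ (π ⟨$⟩ʳ x) ≡⟨ cong (π ⟨$⟩ˡ_) eq ⟩
    π ⟨$⟩ˡ (π ⟨$⟩ʳ y) ≡⟨ inverseˡ π ⟩
    y                  ∎
    where open ≡-Reasoning

  position : Fin n → ℕ
  position x = toℕ (π ⟨$⟩ʳ x)

  InheritsLate : Fin n → Fin n → Set
  InheritsLate x y = ∀ t → y ≺ t → Adj G t x → Adj G t y

  _◁_ : Fin n → Fin n → Set
  x ◁ y = x ≺ y × InheritsLate x y

  _◁?_ : ∀ x y → Dec (x ◁ y)
  x ◁? y = (x ≺? y) ×-dec all? (λ t → (y ≺? t) →-dec (dec G t x →-dec dec G t y))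

  ◁-trans : ∀ {x y z} → x ◁ y → y ◁ z → x ◁ z
  ◁-trans (x≺y , y-inherits) (y≺z , z-inherits) =
    ℕ.<-trans x≺y y≺z , λ t z≺t t~x → z-inherits t z≺t (y-inherits t (ℕ.<-trans y≺z z≺t) t~x)

  -- Positions in π form a linear extension of ◁.
  open Dilworth _◁_ _◁?_ ◁-trans
    position (π-injective ∘ toℕ-injective) proj₁ (λ x → toℕ<n (π ⟨$⟩ʳ x)) public

  edge-if-not-inherits : ∀ {x y} → x ≺ y → ¬ InheritsLate x y → LtEdgeDir G π x y
  edge-if-not-inherits {x} {y} x≺y fails
    with counterexample {P = λ t → y ≺ t × Adj G t x} {Q = λ t → Adj G t y}
           (λ t → (y ≺? t) ×-dec dec G t x) (λ t → dec G t y)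
           (λ inherits → fails (λ t y≺t t~x → inherits t (y≺t , t~x)))
  ... | t , (y≺t , t~x) , t≁y = x≺y , t , y≺t , t~x , t≁y

  incomparable⇒adjacent : ∀ {x y} → Incomparable x y → LtAdj G π x y
  incomparable⇒adjacent {x} {y} x∥y with <-cmp (π ⟨$⟩ʳ x) (π ⟨$⟩ʳ y)
  ... | tri< x≺y _ _ = inj₁ (edge-if-not-inherits x≺y (λ inh → x∥y (inj₂ (inj₁ (x≺y , inh)))))
  ... | tri≈ _ eq _  = contradiction (inj₁ (π-injective eq)) x∥y
  ... | tri> _ _ y≺x = inj₂ (edge-if-not-inherits y≺x (λ inh → x∥y (inj₂ (inj₂ (y≺x , inh)))))

  RightFull : Fin n → Set
  RightFull v = ∀ t → v ≺ t → Adj G t v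

  rightFull? : Decidable RightFull
  rightFull? v = all? (λ t → (v ≺? t) →-dec dec G t v)

  NotRightFull : Subset
  NotRightFull v = ¬ RightFull v

  later-non-neighbour : ∀ {v} → NotRightFull v → Σ (Fin n) λ t → v ≺ t × ¬ Adj G t v
  later-non-neighbour {v} = counterexample (v ≺?_) (λ t → dec G t v)

  -- Of two non-adjacent distinct vertices, the earlier one is not right-full.
  not-right-full-vertex : ¬ Complete G → Σ (Fin n) NotRightFull
  not-right-full-vertex incomplete
    with ¬∀⟶∃¬ n _ (λ u → all? (λ v → ¬? (u ≟ v) →-dec dec G u v)) incomplete
  ... | u , u-incomplete
    with counterexample {P = u ≢_} {Q = Adj G u} (λ v → ¬? (u ≟ v)) (dec G u) u-incomplete
  ... | v , u≢v , u≁v with <-cmp (π ⟨$⟩ʳ u) (π ⟨$⟩ʳ v)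
  ... | tri< u≺v _ _ = u , λ u-full → u≁v (Graph.sym G (u-full v u≺v))
  ... | tri≈ _ eq _  = contradiction (π-injective eq) u≢v
  ... | tri> _ _ v≺u = v , λ v-full → u≁v (v-full u v≺u)

  reordering : Ordering n
  reordering = π ∘ₚ stablePartition (λ p → rightFull? (π ⟨$⟩ˡ p))

  reordering-order : ∀ {x y} → x ≺[ reordering ] y →
    RightFull y ⊎ (NotRightFull x × NotRightFull y × x ≺ y)
  reordering-order moved with stablePartition-order (λ p → rightFull? (π ⟨$⟩ˡ p)) moved
  ... | inj₁ y-full = inj₁ (subst RightFull (inverseˡ π) y-full)
  ... | inj₂ (x-not-full , y-not-full , x≺y) =
    inj₂ (x-not-full ∘ back , y-not-full ∘ back , x≺y)
    where
    back : ∀ {x} → RightFull x → RightFull (π ⟨$⟩ˡ (π ⟨$⟩ʳ x))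
    back = subst RightFull (sym (inverseˡ π))

  -- If s comes before t in the reordering, t ~ s follows once it follows from s ≺ t:
  -- otherwise t ≺ s and t is right-full.
  adjacent-after : ∀ {s t} → s ≺[ reordering ] t → (s ≺ t → Adj G t s) → Adj G t s
  adjacent-after {s} {t} s≺′t from-earlier with reordering-order s≺′t
  ... | inj₂ (_ , _ , s≺t) = from-earlier s≺t
  ... | inj₁ t-full with <-cmp (π ⟨$⟩ʳ s) (π ⟨$⟩ʳ t)
  ...   | tri< s≺t _ _ = from-earlier s≺t
  ...   | tri≈ _ eq _  =
    contradiction s≺′t (ℕ.<-irrefl (cong (λ x → toℕ (reordering ⟨$⟩ʳ x)) (π-injective eq)))
  ...   | tri> _ _ t≺s = Graph.sym G (t-full s t≺s)

  -- The chains of the non-right-full vertices, with the right-full vertices thrown into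
  -- an arbitrary class, are consistent with the reordering: thin(G) ≤ number of chains.
  thin≤chains : ∀ {m} → ChainPartition NotRightFull m → ∀ {v} → NotRightFull v → ThinAtMost G m
  thin≤chains {m} P {v} v-not-full = reordering , class , consistent
    where
    open ChainPartition P
    class : Fin n → Fin m
    class x with rightFull? x
    ... | yes _          = fromℕ< (ℕ.≤-<-trans z≤n (colour-< v-not-full))
    ... | no x-not-full  = fromℕ< (colour-< x-not-full)

    class-colour : ∀ {x} → NotRightFull x → toℕ (class x) ≡ colour x
    class-colour {x} x-not-full with rightFull? x
    ... | yes x-full = contradiction x-full x-not-full
    ... | no _       = toℕ-fromℕ< _

    same-class-inherits : ∀ {r s} → NotRightFull r → NotRightFull s → class r ≡ class s →
      r ≺ s → InheritsLate r s
    same-class-inherits r-nf s-nf same r≺s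
      with chain r-nf s-nf
             (trans (sym (class-colour r-nf)) (trans (cong toℕ same) (class-colour s-nf)))
    ... | inj₁ r≡s                = contradiction r≺s (ℕ.<-irrefl (cong position r≡s))
    ... | inj₂ (inj₁ (_ , inherits)) = inherits
    ... | inj₂ (inj₂ (s≺r , _))   = contradiction s≺r (ℕ.<-asym r≺s)

    consistent : Consistent G reordering class
    consistent r s t r≺′s s≺′t same t~r = adjacent-after s≺′t inherited
      where
      inherited : s ≺ t → Adj G t s
      inherited s≺t with reordering-order r≺′s
      ... | inj₁ s-full             = s-full t s≺t
      ... | inj₂ (r-nf , s-nf , r≺s) = same-class-inherits r-nf s-nf same r≺s t s≺t t~r

  sortedClique : ∀ {m g} → IsAntichain NotRightFull m g → ∀ k → k ≤ m →
    Σ (Fin k → Fin n) λ f → (∀ i j → i <ᶠ j → f i ≺ f j) ×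
      (∀ i j → i ≢ j → LtAdj G π (f i) (f j)) × (∀ i → NotRightFull (f i))
  sortedClique {m} {g} A k k≤m = f , (λ i j → f-increasing) , f-clique , f-not-full
    where
    distinct : ∀ {l l'} → g l ≡ g l' → l ≡ l'
    distinct {l} {l'} eq with l ≟ l'
    ... | yes l≡l' = l≡l'
    ... | no l≢l'  = contradiction (inj₁ eq) (incomparable A l l' l≢l')

    sorted : Σ (Fin m → Fin n) λ e → StrictlyIncreasing e × (∀ i → ∃ λ l → π ⟨$⟩ʳ g l ≡ e i)
    sorted = sortFamily (λ l → π ⟨$⟩ʳ g l) (distinct ∘ π-injective)

    positions : Fin k → Fin n
    positions i = proj₁ sorted (inject≤ i k≤m)

    positions-increasing : StrictlyIncreasing positions
    positions-increasing = proj₁ (proj₂ sorted) ∘ inject≤-increasing k≤m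

    f : Fin k → Fin n
    f i = π ⟨$⟩ˡ positions i

    f-increasing : ∀ {i j} → i <ᶠ j → f i ≺ f j
    f-increasing = subst₂ _<ᶠ_ (sym (inverseʳ π)) (sym (inverseʳ π)) ∘ positions-increasing

    f-injective : ∀ {i j} → f i ≡ f j → i ≡ j
    f-injective eq = increasing⇒injective positions-increasing
      (trans (sym (inverseʳ π)) (trans (cong (π ⟨$⟩ʳ_) eq) (inverseʳ π)))

    source : ∀ i → ∃ λ l → g l ≡ f i
    source i with proj₂ (proj₂ sorted) (inject≤ i k≤m)
    ... | l , π-gl≡position = l , trans (sym (inverseˡ π)) (cong (π ⟨$⟩ˡ_) π-gl≡position)

    f-not-full : ∀ i → NotRightFull (f i)
    f-not-full i = subst NotRightFull (proj₂ (source i)) (members A (proj₁ (source i)))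

    f-clique : ∀ i j → i ≢ j → LtAdj G π (f i) (f j)
    f-clique i j i≢j with source i | source j
    ... | l , gl≡fi | l' , gl'≡fj =
      subst₂ (LtAdj G π) gl≡fi gl'≡fj (incomparable⇒adjacent (incomparable A l l' l≢l'))
      where
      l≢l' : l ≢ l'
      l≢l' refl = i≢j (f-injective (trans (sym gl≡fi) gl'≡fj))

  -- If k ≤ thin(G) and G is not complete, then G_< has a π-ordered clique of k
  -- non-right-full vertices, since thin(G) is at most the width of ◁ on these vertices.
  clique-below-thinness : ¬ Complete G → ∀ k → (∀ m → ThinAtMost G m → k ≤ m) →
    Σ (Fin k → Fin n) λ f → (∀ i j → i <ᶠ j → f i ≺ f j) ×
      (∀ i j → i ≢ j → LtAdj G π (f i) (f j)) × (∀ i → NotRightFull (f i))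
  clique-below-thinness incomplete k minimal =
    sortedClique is-antichain k (minimal width (thin≤chains chains (proj₂ v)))
    where
    v : Σ (Fin n) NotRightFull
    v = not-right-full-vertex incomplete
    open Width (dilworth NotRightFull (λ x → ¬? (rightFull? x)))

lemma4p5 : ∀ {n : ℕ} (G : Graph n) (k : ℕ) (π : Ordering n) →
    ThinIs G k → ¬ Complete G →
    Σ (Fin k → Fin n) λ f →
      (∀ i j → i <ᶠ j → f i ≺[ π ] f j) ×
      (∀ i j → i ≢ j → LtAdj G π (f i) (f j)) ×
      Σ (Fin k) λ i₁ → toℕ i₁ ≡ 0 ×
        Σ (Fin n) λ v → f i₁ ≺[ π ] v × ¬ Adj G v (f i₁)
lemma4p5 G k π (thin-k , minimal) incomplete =
  let f , increasing , edges , not-right-full = clique-below-thinness incomplete k minimal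
  in f , increasing , edges , first , toℕ-fromℕ< 0<k , later-non-neighbour (not-right-full first)
  where
  open OrderedGraph G π
  -- the vertex set is nonempty, so a partition of it into k classes has k > 0
  0<k : 0 < k
  0<k = ℕ.≤-<-trans z≤n (toℕ<n (proj₁ (proj₂ thin-k) (proj₁ (not-right-full-vertex incomplete))))
  first : Fin k
  first = fromℕ< 0<k
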